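{- Let $P$ be a program and $t$ a fresh atom. An interpretation $M\subseteq\mathrm{at}(P)$ is an answer set of $P$ if and only if $M$ is a model of $P$ and, for every $x\in M$, the atom $t_x$ belongs to every inclusion-minimal model of the program $P_x^M\cup\{x_x\}\cup(\mathrm{at}(P)\setminus M)_x$ (where $\{x_x\}$ and $(\mathrm{at}(P)\setminus M)_x$ are read as sets of facts).
   Context: A rule $r$ is an expression $a_1\vee\cdots\vee a_l\leftarrow a_{l+1},\ldots,a_m,\mathit{not}\ a_{m+1},\ldots,\mathit{not}\ a_n$ with propositional atoms; $H(r)$ head atoms, $B^+(r)$, $B^-(r)$ positive/negative body atoms. A fact is a rule $a\leftarrow$ with one head atom and empty body. A program is a finite set of rules; $\mathrm{at}(P)$ its atoms; $P_r=\{r\in P\mid H(r)\ne\emptyset\}$. A set $I$ of atoms satisfies $r$ if $(H(r)\cup B^-(r))\cap I\neq\emptyset$ or $B^+(r)\setminus I\neq\emptyset$; a model satisfies all rules. Reduct: $P^I=\{H(r)\leftarrow B^+(r)\mid r\in P, I\cap B^-(r)=\emptyset\}$. $I$ is an answer set of $P$ if it is an inclusion-minimal model of $P^I$. For a fresh atom $t$, $P_r[t]=\{H(r)\leftarrow t,\mathit{not}\ B^-(r)\mid r\in P_r,B^+(r)=\emptyset\}\cup\{r\in P_r\mid B^+(r)\ne\emptyset\}$. For each $x\in\mathrm{at}(P)$ and $y\in\mathrm{at}(P)\cup\{t\}$, $y_x$ is a fresh atom (all distinct); for $Y\subseteq\mathrm{at}(P)\cup\{t\}$, $Y_x=\{y_x\mid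 y\in Y\}$. Define $P_x=\{B^+_x\leftarrow H_x,\mathit{not}\ B^-\mid (H\leftarrow B^+,\mathit{not}\ B^-)\in P_r[t]\}$ (head is the disjunction of $B^+_x$, positive body $H_x$, negative body the original atoms $B^-$), and $P_x^M=(P^M)_x=\{B^+_x\leftarrow H_x\mid (H\leftarrow B^+,\mathit{not}\ B^-)\in P_r[t],\ B^-\cap M=\emptyset\}$. -}

module Defs where

open import Data.Bool using (Bool; true; false; not)
open import Data.List using (List; []; _∷_; _++_; map; filter; concatMap)
open import Data.List.Relation.Unary.All using (All)
open import Data.List.Relation.Unary.Any using (Any)
open import Data.List.Membership.Propositional using (_∈_; _∉_)
open import Data.List.Relation.Binary.Subset.Propositional using (_⊆_)
import Data.List.Membership.DecPropositional as DecMem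
open import Data.List.Relation.Unary.All using (all?)
open import Data.Maybe using (Maybe; just; nothing)
import Data.Maybe.Properties as MaybeP
open import Data.Product using (_×_; _,_)
open import Data.Sum using (_⊎_)
open import Relation.Nullary using (¬_; ¬?)
import Relation.Nullary
import Relation.Nullary.Decidable
open import Relation.Binary.Definitions using (DecidableEquality)

-- A (disjunctive) rule  H ← B⁺ , not B⁻  over atoms of type B.
record Rule (B : Set) : Set where
  constructor mkRule
  field
    head : List B
    pos  : List B
    neg  : List B
open Rule public

Program : Set → Set
Program B = List (Rule B)

Interp : Set → Set
Interp B = List B

atoms : {B : Set} → Program B → List B
atoms = concatMap (λ r → head r ++ pos r ++ neg r)

fact : {B : Set} → B → Rule B
fact a = mkRule (a ∷ []) [] []

Satisfies : {B : Set} → Interp B → Rule B → Set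
Satisfies I r = Any (_∈ I) (head r ++ neg r) ⊎ Any (λ a → a ∉ I) (pos r)

Model : {B : Set} → Program B → Interp B → Set
Model P I = All (Satisfies I) P

MinimalModel : {B : Set} → Program B → Interp B → Set
MinimalModel {B} P I = Model P I × (∀ (J : Interp B) → Model P J → J ⊆ I → I ⊆ J)

disjoint? : {B : Set} → DecidableEquality B → (X I : List B) → Bool
disjoint? _≟_ X I = Relation.Nullary.does (all? (λ a → ¬? (a ∈? I)) X)
  where open DecMem _≟_

reduct : {B : Set} → DecidableEquality B → Program B → Interp B → Program B
reduct _≟_ P I =
  map (λ r → mkRule (head r) (pos r) [])
      (filter (λ r → Relation.Nullary.Decidable.T? (disjoint? _≟_ (neg r) I)) P)

AnswerSet : {B : Set} → DecidableEquality B → Program B → Interp B → Set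
AnswerSet _≟_ P I = MinimalModel (reduct _≟_ P I) I

nonEmpty : {B : Set} → List B → Bool
nonEmpty [] = false
nonEmpty (_ ∷ _) = true

Pr : {B : Set} → Program B → Program B
Pr P = filter (λ r → Relation.Nullary.Decidable.T? (nonEmpty (head r))) P

-- The fresh atom t is represented by 'nothing'; original atoms a by 'just a'.
-- P_r[t] = { H(r) ← t, not B⁻(r) | r ∈ P_r, B⁺(r) = ∅ } ∪ { r ∈ P_r | B⁺(r) ≠ ∅ }
addT : {A : Set} → Rule A → Rule (Maybe A)
addT (mkRule h [] n)       = mkRule (map just h) (nothing ∷ []) (map just n)
addT (mkRule h (p ∷ ps) n) = mkRule (map just h) (map just (p ∷ ps)) (map just n)

Prt : {A : Set} → Program A → Program (Maybe A)
Prt P = map addT (Pr P)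

-- The fresh atom y_x (y ∈ at(P) ∪ {t}, x ∈ at(P)) is represented by (y , x).
sub : {A : Set} → A → Maybe A → Maybe A × A
sub x y = (y , x)

PxM : {A : Set} → DecidableEquality A → Program A → Interp A → A → Program (Maybe A × A)
PxM _≟_ P M x =
  map (λ r → mkRule (map (sub x) (pos r)) (map (sub x) (head r)) [])
      (reduct (MaybeP.≡-dec _≟_) (Prt P) (map just M))

minus : {A : Set} → DecidableEquality A → List A → List A → List A
minus _≟_ X M = filter (λ a → ¬? (a ∈? M)) X
  where open DecMem _≟_

Qx : {A : Set} → DecidableEquality A → Program A → Interp A → A → Program (Maybe A × A)
Qx _≟_ P M x =
  PxM _≟_ P M x ++ (fact (sub x (just x)) ∷ map (λ a → fact (sub x (just a))) (minus _≟_ (atoms P) M))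

module Submission where

-- The rule  B⁺_x ← H_x  of P_x^M is the contrapositive of  H ← B⁺  read on the copy of the
-- atoms indexed by x: a set N of x-copies satisfies it exactly when the set J of atoms whose
-- x-copy is ABSENT from N satisfies  H ← B⁺  (the fresh atom t stands for an empty body, so
-- this needs t_x ∉ N).  Consequently
--   * a model N of Q_x with t_x ∉ N decodes to J = {a ∈ M | a_x ∉ N}, a model of P^M inside
--     M that misses x (the facts of Q_x force x_x ∈ N and (at(P) ∖ M)_x ⊆ N);
--   * a model J ⊆ M of P^M missing x encodes to N = (at(P) ∖ J)_x, a model of Q_x without t_x.
-- Minimality of M among models of P^M is therefore equivalent to: no model of Q_x (x ∈ M)
-- avoids t_x.  The only remaining ingredient is that below every model of a finite program
-- lies an inclusion-minimal one, proved by searching the finitely many sublists.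

open import Defs
open import Data.List.Membership.Propositional using (_∈_)
open import Data.List.Relation.Binary.Subset.Propositional using (_⊆_)
open import Data.Maybe using (Maybe; just; nothing)
open import Data.Product using (_×_)
open import Function.Bundles using (_⇔_)
open import Relation.Binary.Definitions using (DecidableEquality)

open import Data.Bool using (T)
open import Data.Unit using (tt)
open import Data.Empty using (⊥-elim)
open import Data.Nat using (_<_; _≤_; z≤n; s≤s)
open import Data.Nat.Properties using (m≤n⇒m≤1+n)
open import Data.Nat.Induction using (<-wellFounded)
open import Induction.WellFounded using (Acc; acc)
open import Data.List using (List; []; _∷_; _++_; map; filter; length)
open import Data.List.Relation.Unary.All as All using (All; _∷_; all?)
open import Data.List.Relation.Unary.Any as Any using (here; there; any?)
import Data.List.Relation.Unary.All.Properties as AllP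
import Data.List.Relation.Unary.Any.Properties as AnyP
open import Data.List.Membership.Propositional using (_∉_; find; lose)
open import Data.List.Membership.Propositional.Properties
  using (∈-map⁺; ∈-map⁻; ∈-filter⁺; ∈-filter⁻; ∈-++⁺ˡ; ∈-++⁺ʳ; ∈-++⁻; ∈-concatMap⁺)
import Data.List.Membership.DecPropositional as DecMembership
import Data.Maybe.Properties as MaybeP
import Data.Product.Properties as ProductP
open import Data.Product using (Σ; ∃-syntax; _,_; proj₁; proj₂)
open import Data.Sum using (_⊎_; inj₁; inj₂)
open import Relation.Nullary using (¬_; ¬?; Dec; yes; no; does)
open import Relation.Nullary.Decidable using (_×-dec_; _⊎-dec_; decidable-stable; T?)
open import Relation.Binary.PropositionalEquality using (_≡_; refl)
open import Function.Bundles using (mk⇔; Equivalence)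

T-does⇔ : {Q : Set} (D : Dec Q) → T (does D) ⇔ Q
T-does⇔ (yes q) = mk⇔ (λ _ → q) (λ _ → tt)
T-does⇔ (no ¬q) = mk⇔ (λ ()) (λ q → ¬q q)

positivePart : {B : Set} → Rule B → Rule B
positivePart r = mkRule (head r) (pos r) []

positive-sat⁻ : {B : Set} {I : List B} {h p : List B} → Satisfies I (mkRule h p [])
  → (∃[ a ] a ∈ h × a ∈ I) ⊎ (∃[ a ] a ∈ p × a ∉ I)
positive-sat⁻ {h = h} (inj₁ s) with ∈-++⁻ h (proj₁ (proj₂ (find s)))
... | inj₁ a∈h = inj₁ (proj₁ (find s) , a∈h , proj₂ (proj₂ (find s)))
... | inj₂ ()
positive-sat⁻ (inj₂ s) = inj₂ (find s)

positive-sat⁺ : {B : Set} {I : List B} {h p : List B}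
  → (∃[ a ] a ∈ h × a ∈ I) ⊎ (∃[ a ] a ∈ p × a ∉ I) → Satisfies I (mkRule h p [])
positive-sat⁺ (inj₁ (a , a∈h , a∈I)) = inj₁ (lose (∈-++⁺ˡ a∈h) a∈I)
positive-sat⁺ (inj₂ (a , a∈p , a∉I)) = inj₂ (lose a∈p a∉I)

positivePart-sat : {B : Set} {I : List B} (r : Rule B) → Satisfies I (positivePart r) → Satisfies I r
positivePart-sat r s with positive-sat⁻ s
... | inj₁ (a , a∈h , a∈I) = inj₁ (lose (∈-++⁺ˡ a∈h) a∈I)
... | inj₂ (a , a∈p , a∉I) = inj₂ (lose a∈p a∉I)

satisfies-≐ : {B : Set} {I I′ : List B} (r : Rule B) → I ⊆ I′ → I′ ⊆ I
  → Satisfies I r → Satisfies I′ r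
satisfies-≐ r I⊆I′ I′⊆I (inj₁ s) = inj₁ (Any.map I⊆I′ s)
satisfies-≐ r I⊆I′ I′⊆I (inj₂ s) = inj₂ (Any.map (λ a∉I a∈I′ → a∉I (I′⊆I a∈I′)) s)

fact-true : {B : Set} {Q : Program B} {N : List B} {y : B} → Model Q N → fact y ∈ Q → y ∈ N
fact-true mQ f∈Q with All.lookup mQ f∈Q
... | inj₁ (here y∈N) = y∈N
... | inj₂ ()

fact-sat : {B : Set} {N : List B} {y : B} → y ∈ N → Satisfies N (fact y)
fact-sat y∈N = inj₁ (here y∈N)

ruleAtoms : {B : Set} → Rule B → List B
ruleAtoms r = head r ++ pos r ++ neg r

head⊆ruleAtoms : {B : Set} (r : Rule B) → head r ⊆ ruleAtoms r
head⊆ruleAtoms r = ∈-++⁺ˡ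

pos⊆ruleAtoms : {B : Set} (r : Rule B) → pos r ⊆ ruleAtoms r
pos⊆ruleAtoms r a∈ = ∈-++⁺ʳ (head r) (∈-++⁺ˡ a∈)

ruleAtoms⊆atoms : {B : Set} {P : Program B} {r : Rule B} → r ∈ P → ruleAtoms r ⊆ atoms P
ruleAtoms⊆atoms r∈P a∈ = ∈-concatMap⁺ ruleAtoms (lose r∈P a∈)

module Finite {B : Set} (_≟_ : DecidableEquality B) where
  open DecMembership _≟_ using (_∈?_)

  disjoint⇔ : (X I : List B) → T (disjoint? _≟_ X I) ⇔ All (_∉ I) X
  disjoint⇔ X I = T-does⇔ (all? (λ a → ¬? (a ∈? I)) X)

  reduct-complete : {P : Program B} {I : List B} {r : Rule B} → r ∈ P
    → T (disjoint? _≟_ (neg r) I) → positivePart r ∈ reduct _≟_ P I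
  reduct-complete r∈P dis = ∈-map⁺ positivePart (∈-filter⁺ _ r∈P dis)

  reduct-sound : {P : Program B} {I : List B} {r′ : Rule B} → r′ ∈ reduct _≟_ P I
    → ∃[ r ] r ∈ P × T (disjoint? _≟_ (neg r) I) × r′ ≡ positivePart r
  reduct-sound {P} r′∈ with ∈-map⁻ positivePart r′∈
  ... | r , r∈f , r′≡ = r , proj₁ (∈-filter⁻ _ {xs = P} r∈f) , proj₂ (∈-filter⁻ _ {xs = P} r∈f) , r′≡

  model⇔reduct-model : (P : Program B) (I : List B) → Model P I ⇔ Model (reduct _≟_ P I) I
  model⇔reduct-model P I = mk⇔ toReduct fromReduct
    where
      toReduct : Model P I → Model (reduct _≟_ P I) I
      toReduct mP = All.tabulate λ r′∈ → sat (reduct-sound r′∈)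
        where
          sat : {r′ : Rule B} → ∃[ r ] r ∈ P × T (disjoint? _≟_ (neg r) I) × r′ ≡ positivePart r
            → Satisfies I r′
          sat (r , r∈P , dis , refl) with All.lookup mP r∈P
          ... | inj₂ s = inj₂ s
          ... | inj₁ s with AnyP.++⁻ (head r) s
          ...   | inj₁ s′ = inj₁ (AnyP.++⁺ˡ s′)
          ...   | inj₂ s′ = ⊥-elim (AllP.All¬⇒¬Any (Equivalence.to (disjoint⇔ (neg r) I) dis) s′)

      fromReduct : Model (reduct _≟_ P I) I → Model P I
      fromReduct mR = All.tabulate sat
        where
          sat : {r : Rule B} → r ∈ P → Satisfies I r
          sat {r} r∈P with any? (_∈? I) (neg r)
          ... | yes s = inj₁ (AnyP.++⁺ʳ (head r) s)
          ... | no ¬s with All.lookup mR (reduct-complete r∈P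
                             (Equivalence.from (disjoint⇔ (neg r) I) (AllP.¬Any⇒All¬ (neg r) ¬s)))
          ...   | s = positivePart-sat r s

  constraint-downward : {I J : List B} (p n : List B) → J ⊆ I → T (disjoint? _≟_ n I)
    → Satisfies I (mkRule [] p n) → Satisfies J (mkRule [] p [])
  constraint-downward {I} p n J⊆I dis (inj₁ s) =
    ⊥-elim (AllP.All¬⇒¬Any (Equivalence.to (disjoint⇔ n I) dis) s)
  constraint-downward p n J⊆I dis (inj₂ s) = inj₂ (Any.map (λ a∉I a∈J → a∉I (J⊆I a∈J)) s)

  sat? : (I : List B) (r : Rule B) → Dec (Satisfies I r)
  sat? I r = any? (_∈? I) (head r ++ neg r) ⊎-dec any? (λ a → ¬? (a ∈? I)) (pos r)

  model? : (Q : Program B) (I : List B) → Dec (Model Q I)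
  model? Q I = all? (sat? I) Q

  ⊆? : (L S : List B) → Dec (L ⊆ S)
  ⊆? L S with all? (_∈? S) L
  ... | yes all∈ = yes (All.lookup all∈)
  ... | no ¬all∈ = no (λ L⊆S → ¬all∈ (All.tabulate L⊆S))

  -- All sublists of a list; every subset of L is represented by one of them (via filter).
  sublists : List B → List (List B)
  sublists [] = [] ∷ []
  sublists (a ∷ l) = map (a ∷_) (sublists l) ++ sublists l

  sublists-⊆ : (L : List B) {S : List B} → S ∈ sublists L → S ⊆ L
  sublists-⊆ [] (here refl) ()
  sublists-⊆ (a ∷ l) S∈ with ∈-++⁻ (map (a ∷_) (sublists l)) S∈
  ... | inj₂ S∈l = λ b∈ → there (sublists-⊆ l S∈l b∈)
  ... | inj₁ S∈a with ∈-map⁻ (a ∷_) S∈a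
  ...   | S′ , S′∈ , refl = λ { (here refl) → here refl ; (there b∈) → there (sublists-⊆ l S′∈ b∈) }

  sublists-length : (L : List B) {S : List B} → S ∈ sublists L → length S ≤ length L
  sublists-length [] (here refl) = z≤n
  sublists-length (a ∷ l) S∈ with ∈-++⁻ (map (a ∷_) (sublists l)) S∈
  ... | inj₂ S∈l = m≤n⇒m≤1+n (sublists-length l S∈l)
  ... | inj₁ S∈a with ∈-map⁻ (a ∷_) S∈a
  ...   | S′ , S′∈ , refl = s≤s (sublists-length l S′∈)

  sublists-shorter : (L : List B) {S : List B} → S ∈ sublists L → ¬ (L ⊆ S) → length S < length L
  sublists-shorter [] (here refl) L⊈S = ⊥-elim (L⊈S (λ ()))
  sublists-shorter (a ∷ l) S∈ L⊈S with ∈-++⁻ (map (a ∷_) (sublists l)) S∈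
  ... | inj₂ S∈l = s≤s (sublists-length l S∈l)
  ... | inj₁ S∈a with ∈-map⁻ (a ∷_) S∈a
  ...   | S′ , S′∈ , refl = s≤s (sublists-shorter l S′∈ λ l⊆S′ →
            L⊈S λ { (here refl) → here refl ; (there b∈) → there (l⊆S′ b∈) })

  filter∈sublists : {Q : B → Set} (Q? : (a : B) → Dec (Q a)) (L : List B) → filter Q? L ∈ sublists L
  filter∈sublists Q? [] = here refl
  filter∈sublists Q? (a ∷ l) with Q? a
  ... | yes _ = ∈-++⁺ˡ (∈-map⁺ (a ∷_) (filter∈sublists Q? l))
  ... | no _ = ∈-++⁺ʳ (map (a ∷_) (sublists l)) (filter∈sublists Q? l)

  -- Below every model of a finite program lies an inclusion-minimal model: either some
  -- sublist of L is a model missing part of L (recurse on it, it is shorter), or L is minimal.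
  minimal-model-below : (Q : Program B) (L : List B) → Model Q L
    → Σ (List B) λ N → MinimalModel Q N × N ⊆ L
  minimal-model-below Q L = go L (<-wellFounded (length L))
    where
      go : (L : List B) → Acc _<_ (length L) → Model Q L → Σ (List B) λ N → MinimalModel Q N × N ⊆ L
      go L (acc smaller) mL with any? (λ S → model? Q S ×-dec ¬? (⊆? L S)) (sublists L)
      ... | yes smallerModel with find smallerModel
      ...   | S , S∈ , mS , L⊈S with go S (smaller (sublists-shorter L S∈ L⊈S)) mS
      ...     | N , minN , N⊆S = N , minN , (λ a∈N → sublists-⊆ L S∈ (N⊆S a∈N))
      go L (acc smaller) mL | no noSmallerModel = L , (mL , minimal) , (λ a∈L → a∈L)
        where
          -- a model J ⊆ L has the same atoms as the sublist  filter (_∈ J) L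
          minimal : ∀ J → Model Q J → J ⊆ L → L ⊆ J
          minimal J mJ J⊆L = λ a∈L → proj₂ (∈-filter⁻ (_∈? J) {xs = L} (L⊆S a∈L))
            where
              S = filter (_∈? J) L
              mS : Model Q S
              mS = All.map (λ {r} → satisfies-≐ r (λ a∈J → ∈-filter⁺ (_∈? J) (J⊆L a∈J) a∈J)
                                       (λ a∈S → proj₂ (∈-filter⁻ (_∈? J) {xs = L} a∈S))) mJ
              L⊆S : L ⊆ S
              L⊆S = decidable-stable (⊆? L S)
                      (λ L⊈S → noSmallerModel (lose (filter∈sublists (_∈? J) L) (mS , L⊈S)))

addT-neg : {A : Set} (r : Rule A) → neg (addT r) ≡ map just (neg r)
addT-neg (mkRule h [] n) = refl
addT-neg (mkRule h (p ∷ ps) n) = refl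

module Duality {A : Set} (_≟_ : DecidableEquality A) where
  open DecMembership _≟_ using (_∈?_)

  X : Set
  X = Maybe A × A

  _≟ᴹ_ : DecidableEquality (Maybe A)
  _≟ᴹ_ = MaybeP.≡-dec _≟_

  _≟ˣ_ : DecidableEquality X
  _≟ˣ_ = ProductP.≡-dec _≟ᴹ_ _≟_

  open DecMembership _≟ˣ_ using () renaming (_∈?_ to _∈ˣ?_)

  dualize : A → Rule (Maybe A) → Rule X
  dualize x r = mkRule (map (sub x) (pos r)) (map (sub x) (head r)) []

  dualRule : A → Rule A → Rule X
  dualRule x r = dualize x (positivePart (addT r))

  subJust⁺ : {x a : A} {L : List A} → a ∈ L → sub x (just a) ∈ map (sub x) (map just L)
  subJust⁺ {x} a∈L = ∈-map⁺ (sub x) (∈-map⁺ just a∈L)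

  subJust⁻ : {x : A} {z : X} {L : List A} → z ∈ map (sub x) (map just L)
    → ∃[ a ] a ∈ L × z ≡ sub x (just a)
  subJust⁻ {x} z∈ with ∈-map⁻ (sub x) z∈
  ... | y , y∈ , refl with ∈-map⁻ just y∈
  ...   | a , a∈L , refl = a , a∈L , refl

  dual-head⁺ : (x : A) (r : Rule A) {a : A} → a ∈ pos r → sub x (just a) ∈ head (dualRule x r)
  dual-head⁺ x (mkRule h [] n) ()
  dual-head⁺ x (mkRule h (p ∷ ps) n) a∈ = subJust⁺ a∈

  dual-head⁻ : (x : A) (r : Rule A) {z : X} → z ∈ head (dualRule x r)
    → z ≡ sub x nothing ⊎ ∃[ a ] a ∈ pos r × z ≡ sub x (just a)
  dual-head⁻ x (mkRule h [] n) (here refl) = inj₁ refl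
  dual-head⁻ x (mkRule h (p ∷ ps) n) z∈ = inj₂ (subJust⁻ z∈)

  dual-pos⁺ : (x : A) (r : Rule A) {a : A} → a ∈ head r → sub x (just a) ∈ pos (dualRule x r)
  dual-pos⁺ x (mkRule h [] n) = subJust⁺
  dual-pos⁺ x (mkRule h (p ∷ ps) n) = subJust⁺

  dual-pos⁻ : (x : A) (r : Rule A) {z : X} → z ∈ pos (dualRule x r)
    → ∃[ a ] a ∈ head r × z ≡ sub x (just a)
  dual-pos⁻ x (mkRule h [] n) = subJust⁻
  dual-pos⁻ x (mkRule h (p ∷ ps) n) = subJust⁻

  Encodes : A → List A → List X → List A → Set
  Encodes x J N L = ∀ {a} → a ∈ L → (a ∈ J ⇔ sub x (just a) ∉ N)

  duality : (x : A) (r : Rule A) {J : List A} {N : List X} → Encodes x J N (ruleAtoms r)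
    → sub x nothing ∉ N → Satisfies N (dualRule x r) ⇔ Satisfies J (positivePart r)
  duality x r {J} {N} enc t∉N = mk⇔ decode encode
    where
      decode : Satisfies N (dualRule x r) → Satisfies J (positivePart r)
      decode s with positive-sat⁻ s
      ... | inj₂ (z , z∈ , z∉N) with dual-pos⁻ x r z∈
      ...   | a , a∈h , refl =
              positive-sat⁺ (inj₁ (a , a∈h , Equivalence.from (enc (head⊆ruleAtoms r a∈h)) z∉N))
      decode s | inj₁ (z , z∈ , z∈N) with dual-head⁻ x r z∈
      ...   | inj₁ refl = ⊥-elim (t∉N z∈N)
      ...   | inj₂ (a , a∈p , refl) =
              positive-sat⁺ (inj₂ (a , a∈p , λ a∈J → Equivalence.to (enc (pos⊆ruleAtoms r a∈p)) a∈J z∈N))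

      encode : Satisfies J (positivePart r) → Satisfies N (dualRule x r)
      encode s with positive-sat⁻ s
      ... | inj₁ (a , a∈h , a∈J) =
            positive-sat⁺ (inj₂ (sub x (just a) , dual-pos⁺ x r a∈h ,
                                 Equivalence.to (enc (head⊆ruleAtoms r a∈h)) a∈J))
      ... | inj₂ (a , a∈p , a∉J) =
            positive-sat⁺ (inj₁ (sub x (just a) , dual-head⁺ x r a∈p ,
              decidable-stable (sub x (just a) ∈ˣ? N)
                (λ a∉N → a∉J (Equivalence.from (enc (pos⊆ruleAtoms r a∈p)) a∉N))))

  addT-disjoint : (r : Rule A) (M : List A)
    → T (disjoint? _≟_ (neg r) M) ⇔ T (disjoint? _≟ᴹ_ (neg (addT r)) (map just M))
  addT-disjoint r M = mk⇔ to from
    where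
      open Finite
      to : T (disjoint? _≟_ (neg r) M) → T (disjoint? _≟ᴹ_ (neg (addT r)) (map just M))
      to dis rewrite addT-neg r = Equivalence.from (disjoint⇔ _≟ᴹ_ (map just (neg r)) (map just M))
        (AllP.map⁺ (All.map (λ a∉M ja∈ → a∉M (unjust ja∈)) (Equivalence.to (disjoint⇔ _≟_ (neg r) M) dis)))
        where
          unjust : {a : A} → just a ∈ map just M → a ∈ M
          unjust ja∈ with ∈-map⁻ just ja∈
          ... | _ , a∈M , refl = a∈M

      from : T (disjoint? _≟ᴹ_ (neg (addT r)) (map just M)) → T (disjoint? _≟_ (neg r) M)
      from dis rewrite addT-neg r = Equivalence.from (disjoint⇔ _≟_ (neg r) M)
        (All.map (λ ja∉M a∈M → ja∉M (∈-map⁺ just a∈M))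
          (AllP.map⁻ (Equivalence.to (disjoint⇔ _≟ᴹ_ (map just (neg r)) (map just M)) dis)))

  module Program (P : Program A) (M : Interp A) where
    open Finite _≟ᴹ_ using () renaming (reduct-complete to reductᴹ-complete; reduct-sound to reductᴹ-sound)

    Qx-dual : (x : A) {r : Rule A} → r ∈ P → T (nonEmpty (head r)) → T (disjoint? _≟_ (neg r) M)
      → dualRule x r ∈ Qx _≟_ P M x
    Qx-dual x {r} r∈P nonempty dis = ∈-++⁺ˡ (∈-map⁺ (dualize x)
      (reductᴹ-complete (∈-map⁺ addT (∈-filter⁺ (λ r → T? (nonEmpty (head r))) r∈P nonempty))
                        (Equivalence.to (addT-disjoint r M) dis)))

    PxM-sound : (x : A) {r′ : Rule X} → r′ ∈ PxM _≟_ P M x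
      → ∃[ r ] r ∈ P × T (disjoint? _≟_ (neg r) M) × r′ ≡ dualRule x r
    PxM-sound x r′∈ with ∈-map⁻ (dualize x) r′∈
    ... | r″ , r″∈ , refl with reductᴹ-sound {P = Prt P} {I = map just M} r″∈
    ...   | rt , rt∈ , dis , refl with ∈-map⁻ addT rt∈
    ...     | r , r∈Pr , refl =
              r , proj₁ (∈-filter⁻ (λ r → T? (nonEmpty (head r))) {xs = P} r∈Pr) ,
              Equivalence.from (addT-disjoint r M) dis , refl

    Qx-fact-x : (x : A) → fact (sub x (just x)) ∈ Qx _≟_ P M x
    Qx-fact-x x = ∈-++⁺ʳ (PxM _≟_ P M x) (here refl)

    Qx-fact-outside : (x : A) {a : A} → a ∈ atoms P → a ∉ M → fact (sub x (just a)) ∈ Qx _≟_ P M x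
    Qx-fact-outside x {a} a∈P a∉M = ∈-++⁺ʳ (PxM _≟_ P M x)
      (there (∈-map⁺ (λ b → fact (sub x (just b))) (∈-filter⁺ (λ b → ¬? (b ∈? M)) a∈P a∉M)))

    Qx-model : (x : A) {N : List X}
      → (∀ {r} → r ∈ P → T (disjoint? _≟_ (neg r) M) → Satisfies N (dualRule x r))
      → sub x (just x) ∈ N → (∀ {a} → a ∈ minus _≟_ (atoms P) M → sub x (just a) ∈ N)
      → Model (Qx _≟_ P M x) N
    Qx-model x {N} duals x∈N outside∈N =
      AllP.++⁺ (All.tabulate λ r′∈ → dualSat (PxM-sound x r′∈))
               (fact-sat x∈N ∷ AllP.map⁺ (All.tabulate λ a∈ → fact-sat (outside∈N a∈)))
      where
        dualSat : {r′ : Rule X} → ∃[ r ] r ∈ P × T (disjoint? _≟_ (neg r) M) × r′ ≡ dualRule x r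
          → Satisfies N r′
        dualSat (r , r∈P , dis , refl) = duals r∈P dis

    decode : A → List X → List A
    decode x N = filter (λ a → ¬? (sub x (just a) ∈ˣ? N)) M

    decode⊆M : (x : A) (N : List X) → decode x N ⊆ M
    decode⊆M x N a∈ = proj₁ (∈-filter⁻ _ {xs = M} a∈)

    decode-encodes : (x : A) {N : List X} → Model (Qx _≟_ P M x) N → Encodes x (decode x N) N (atoms P)
    decode-encodes x {N} mN {a} a∈P = mk⇔ (λ a∈J → proj₂ (∈-filter⁻ _ {xs = M} a∈J)) fromAbsent
      where
        fromAbsent : sub x (just a) ∉ N → a ∈ decode x N
        fromAbsent a∉N with a ∈? M
        ... | yes a∈M = ∈-filter⁺ _ a∈M a∉N
        ... | no a∉M = ⊥-elim (a∉N (fact-true mN (Qx-fact-outside x a∈P a∉M)))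

    decode-model : Model P M → (x : A) {N : List X} → Model (Qx _≟_ P M x) N → sub x nothing ∉ N
      → Model (reduct _≟_ P M) (decode x N) × x ∉ decode x N
    decode-model mP x {N} mN t∉N = All.tabulate (λ r′∈ → sat (Finite.reduct-sound _≟_ r′∈)) , x∉J
      where
        x∉J : x ∉ decode x N
        x∉J x∈J = proj₂ (∈-filter⁻ _ {xs = M} x∈J) (fact-true mN (Qx-fact-x x))

        sat : {r′ : Rule A} → ∃[ r ] r ∈ P × T (disjoint? _≟_ (neg r) M) × r′ ≡ positivePart r
          → Satisfies (decode x N) r′
        sat (mkRule [] p n , r∈P , dis , refl) =
          Finite.constraint-downward _≟_ p n (decode⊆M x N) dis (All.lookup mP r∈P)
        sat (r@(mkRule (_ ∷ _) p n) , r∈P , dis , refl) =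
          Equivalence.to (duality x r (λ a∈ → decode-encodes x mN (ruleAtoms⊆atoms r∈P a∈)) t∉N)
            (All.lookup mN (Qx-dual x r∈P tt dis))

    encode : A → List A → List X
    encode x J = map (λ a → sub x (just a)) (minus _≟_ (atoms P) J)

    t∉encode : (x : A) (J : List A) → sub x nothing ∉ encode x J
    t∉encode x J t∈ with ∈-map⁻ _ t∈
    ... | _ , _ , ()

    encode-encodes : (x : A) (J : List A) → Encodes x J (encode x J) (atoms P)
    encode-encodes x J {a} a∈P = mk⇔ toAbsent fromAbsent
      where
        toAbsent : a ∈ J → sub x (just a) ∉ encode x J
        toAbsent a∈J a∈N with ∈-map⁻ _ a∈N
        ... | _ , b∈ , refl = proj₂ (∈-filter⁻ (λ b → ¬? (b ∈? J)) {xs = atoms P} b∈) a∈J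

        fromAbsent : sub x (just a) ∉ encode x J → a ∈ J
        fromAbsent a∉N = decidable-stable (a ∈? J)
          (λ a∉J → a∉N (∈-map⁺ _ (∈-filter⁺ (λ b → ¬? (b ∈? J)) a∈P a∉J)))

    encode-model : M ⊆ atoms P → {J : List A} → Model (reduct _≟_ P M) J → J ⊆ M
      → {x : A} → x ∈ M → x ∉ J → Model (Qx _≟_ P M x) (encode x J)
    encode-model M⊆P {J} mJ J⊆M {x} x∈M x∉J = Qx-model x duals (present (M⊆P x∈M) x∉J) outside
      where
        present : {a : A} → a ∈ atoms P → a ∉ J → sub x (just a) ∈ encode x J
        present a∈P a∉J = ∈-map⁺ _ (∈-filter⁺ (λ b → ¬? (b ∈? J)) a∈P a∉J)

        outside : ∀ {a} → a ∈ minus _≟_ (atoms P) M → sub x (just a) ∈ encode x J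
        outside a∈ with ∈-filter⁻ (λ b → ¬? (b ∈? M)) {xs = atoms P} a∈
        ... | a∈P , a∉M = present a∈P (λ a∈J → a∉M (J⊆M a∈J))

        duals : ∀ {r} → r ∈ P → T (disjoint? _≟_ (neg r) M) → Satisfies (encode x J) (dualRule x r)
        duals {r} r∈P dis =
          Equivalence.from (duality x r (λ a∈ → encode-encodes x J (ruleAtoms⊆atoms r∈P a∈)) (t∉encode x J))
            (All.lookup mJ (Finite.reduct-complete _≟_ r∈P dis))

proposition5 : {A : Set} → (_≟_ : DecidableEquality A) → (P : Program A) → (M : Interp A) → M ⊆ atoms P
    → AnswerSet _≟_ P M ⇔ (Model P M × (∀ x → x ∈ M → ∀ (N : Interp (Maybe A × A)) → MinimalModel (Qx _≟_ P M x) N → sub x nothing ∈ N))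
proposition5 _≟_ P M M⊆P = mk⇔ onlyIf if
  where
    open Duality _≟_
    open Program P M
    open Finite using (model⇔reduct-model; minimal-model-below)
    open DecMembership _≟_ using (_∈?_)
    open DecMembership _≟ˣ_ using () renaming (_∈?_ to _∈ˣ?_)

    TInMinimalModels : Set
    TInMinimalModels = ∀ x → x ∈ M → ∀ (N : Interp X) → MinimalModel (Qx _≟_ P M x) N → sub x nothing ∈ N

    -- If t_x were missing from a model N of Q_x, decoding N would give a model of P^M
    -- inside M without x, contradicting the minimality of M.
    onlyIf : AnswerSet _≟_ P M → Model P M × TInMinimalModels
    onlyIf (mR , minimal) = mP , λ x x∈M N (mN , _) → decidable-stable (sub x nothing ∈ˣ? N) λ t∉N →
      let (mJ , x∉J) = decode-model mP x mN t∉N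
      in x∉J (minimal (decode x N) mJ (decode⊆M x N) x∈M)
      where
        mP : Model P M
        mP = Equivalence.from (model⇔reduct-model _≟_ P M) mR

    -- If a model J ⊆ M of P^M missed some x ∈ M, a minimal model of Q_x below the encoding
    -- of J would not contain t_x.
    if : Model P M × TInMinimalModels → AnswerSet _≟_ P M
    if (mP , tInMinimal) = Equivalence.to (model⇔reduct-model _≟_ P M) mP ,
      λ J mJ J⊆M {x} x∈M → decidable-stable (x ∈? J) λ x∉J →
        let (N , minN , N⊆encoding) = minimal-model-below _≟ˣ_ (Qx _≟_ P M x) (encode x J)
                                        (encode-model M⊆P mJ J⊆M x∈M x∉J)
        in t∉encode x J (N⊆encoding (tInMinimal x x∈M N minN))
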